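{- For every $n\in\mathbb{Z}^+$ and every sequence $S=(s_1,s_2,\dots)$ of positive integers, $$|\mathrm{FR}^{\mathrm{T3}}_{n,S}|=\sum_{k=1}^n\sum_{(c_1,\dots,c_k)\in M_{S,k,n}}\binom{n}{c_1,c_2,\dots,c_k},$$ where $M_{S,k,n}=\{(c_1,\dots,c_k): c_1+\cdots+c_k=n \text{ and } c_i\in\{1,\dots,s_i\}\text{ for all }1\le i\le k\}$.
   Context: A Fubini ranking of length $n$ is a tuple $(b_1,\dots,b_n)\in[n]^n$ that satisfies two conditions. First, some $b_i$ equals $1$. Second, for every value $x$ occurring exactly $k>0$ times, the next larger value occurring in the tuple (if there is one) is $x+k$. If a Fubini ranking $\alpha$ has $k$ distinct values, its position vector is $(c_1,\dots,c_k)$, where $c_i$ is the number of entries of $\alpha$ equal to $1+c_1+\cdots+c_{i-1}$. A sequence $S=(s_1,s_2,\dots)$ of positive integers is a block sequence for $\alpha$ if $c_i\le s_i$ for $i=1,\dots,k$. $\mathrm{FR}^{\mathrm{T3}}_{n,S}$ is the set of Fubini rankings of length $n$ for which $S$ is a block sequence. -}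

module Defs where

open import Data.Nat using (ℕ; zero; suc; _+_; _*_; _≤_; _<_; _!; _/_; NonZero)
open import Data.Nat.Properties using (_≟_; _!≢0; m*n≢0)
open import Data.List using (List; []; _∷_; length; map; concatMap; filter; upTo; deduplicate)
open import Data.Nat.ListAction using (sum)
open import Data.Vec using (Vec; toList; count)
open import Data.Vec.Relation.Unary.All using (All)
open import Data.Vec.Relation.Unary.Any using (Any)
open import Data.Product using (_×_)
open import Relation.Binary.PropositionalEquality using (_≡_)
open import Relation.Nullary using (¬_)

occ : ∀ {n} → ℕ → Vec ℕ n → ℕ
occ x α = count (x ≟_) α

InRange : ∀ n → Vec ℕ n → Set
InRange n α = All (λ b → 1 ≤ b × b ≤ n) α

record IsFubiniRanking (n : ℕ) (α : Vec ℕ n) : Set where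
  field
    inRange : InRange n α
    hasOne  : Any (_≡ 1) α
    next    : ∀ x y → 0 < occ x α → 0 < occ y α → x < y →
              (∀ z → x < z → z < y → occ z α ≡ 0) →
              y ≡ x + occ x α

distinctValues : ∀ {n} → Vec ℕ n → ℕ
distinctValues α = length (deduplicate _≟_ (toList α))

-- position vector, 0-indexed: posC α i = c_{i+1},
-- partialC α i = c₁ + ⋯ + c_i,
-- c_{i+1} = number of entries of α equal to 1 + c₁ + ⋯ + c_i.
posC     : ∀ {n} → Vec ℕ n → ℕ → ℕ
partialC : ∀ {n} → Vec ℕ n → ℕ → ℕ
posC α i = occ (1 + partialC α i) α
partialC α zero    = 0
partialC α (suc i) = partialC α i + posC α i

-- S = (s₁, s₂, …) is modelled as s : ℕ → ℕ with s i = s_{i+1}.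
-- S is a block sequence for α if c_i ≤ s_i for i = 1,…,k (k = #distinct values).
IsBlockSequence : ∀ {n} → (ℕ → ℕ) → Vec ℕ n → Set
IsBlockSequence s α = ∀ i → i < distinctValues α → posC α i ≤ s i

-- FR^{T3}_{n,S}: Fubini rankings of length n for which S is a block sequence.
-- Proof fields are irrelevant, so elements are determined by their tuple.
record FR-T3 (n : ℕ) (s : ℕ → ℕ) : Set where
  constructor fr
  field
    tuple        : Vec ℕ n
    .isFubini    : IsFubiniRanking n tuple
    .isBlockSeq  : IsBlockSequence s tuple

oneTo : ℕ → List ℕ
oneTo m = map suc (upTo m)

box : (ℕ → ℕ) → ℕ → List (List ℕ)
box s zero    = [] ∷ []
box s (suc k) = concatMap (λ c → map (c ∷_) (box (λ i → s (suc i)) k)) (oneTo (s 0))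

M : (ℕ → ℕ) → ℕ → ℕ → List (List ℕ)
M s k n = filter (λ c → sum c ≟ n) (box s k)

prodFact : List ℕ → ℕ
prodFact []       = 1
prodFact (c ∷ cs) = c ! * prodFact cs

prodFact≢0 : ∀ cs → NonZero (prodFact cs)
prodFact≢0 []       = _
prodFact≢0 (c ∷ cs) = m*n≢0 (c !) (prodFact cs) {{c !≢0}} {{prodFact≢0 cs}}

multinomial : ℕ → List ℕ → ℕ
multinomial n cs = (n ! / prodFact cs) {{prodFact≢0 cs}}

rhs : ℕ → (ℕ → ℕ) → ℕ
rhs n s = sum (map (λ k → sum (map (multinomial n) (M s k n))) (oneTo n))

-- A tuple is a Fubini ranking exactly when every entry equals one plus the number of strictly
-- smaller entries (`Ranked`). The entries equal to 1 form the first block, of size c₁; deleting them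
-- and lowering every other entry by c₁ leaves a Fubini ranking of length n − c₁ with one block fewer
-- and position vector (c₂, c₃, …), and the original is recovered from this remainder together with
-- the c₁-subset of positions that held the 1s. Hence the rankings with k blocks for the block
-- sequence (s₁, s₂, …) number Σ_{c₁ ≤ s₁} (n choose c₁) times those of length n − c₁ with k − 1
-- blocks for (s₂, s₃, …). The multinomial sum satisfies the same recursion, because
-- (n; c₁, …, c_k) = (n choose c₁) · (n − c₁; c₂, …, c_k), and the bijection with Fin (rhs n s) is
-- assembled along it.

module Submission where

open import Defs
open import Data.Bool using (Bool; true; false; not; _∧_; T)
import Data.Bool.Properties as Bool
open import Data.Empty using (⊥-elim; ⊥-elim-irr)
open import Data.Fin using (Fin; zero; suc; toℕ; fromℕ<)
open import Data.Fin.Properties using (+↔⊎; *↔×; toℕ-fromℕ<; toℕ<n; toℕ-injective)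
open import Data.List using (List; []; _∷_; length; map; filter; concatMap; applyUpTo; _++_; deduplicate)
open import Data.List.Extrema.Nat using (min; argmin-sel; min≤⊤; min≤xs)
open import Data.List.Membership.Propositional using (_∈_)
open import Data.List.Membership.Propositional.Properties using (∈-deduplicate⁺; ∈-map⁺; ∈-map⁻; ∈-filter⁻)
open import Data.List.Properties
  using ( filter-accept; filter-reject; filter-idem; filter-all; filter-++; map-++; map-applyUpTo; map-cong
        ; length-map; length-deduplicate; ≡-dec)
open import Data.List.Relation.Unary.All using (All; []; _∷_; lookup; tabulate)
import Data.List.Relation.Unary.All as ListAll
open import Data.List.Relation.Unary.Any using (here; there)
import Data.List.Relation.Unary.Any as ListAny
open import Data.List.Relation.Unary.Unique.Propositional using (Unique; []; _∷_)
open import Data.Nat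
  using (ℕ; zero; suc; _+_; _*_; _∸_; _≤_; _<_; z≤n; s≤s; s≤s⁻¹; _!; _/_; NonZero; _≡ᵇ_; _<ᵇ_; _≟_; _≤?_; _<?_)
open import Data.List.Relation.Unary.Unique.DecPropositional.Properties _≟_ using (deduplicate-!)
open import Data.Nat.Combinatorics using (_C_; nCk+nC[k+1]≡[n+1]C[k+1]; nCk≡n!/k![n-k]!; k![n∸k]!∣n!; k>n⇒nCk≡0)
open import Data.Nat.DivMod using (m*n/n≡m; m/n*n≡m)
open import Data.Nat.Induction using (<-rec)
open import Data.Nat.ListAction using (sum)
open import Data.Nat.ListAction.Properties using (sum-++)
open import Data.Nat.Properties
open import Algebra.Properties.CommutativeSemigroup +-commutativeSemigroup using (x∙yz≈y∙xz)
open import Data.Nat.Solver using (module +-*-Solver)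
open import Data.Product using (Σ; ∃; _×_; _,_; proj₁; proj₂)
open import Data.Product.Function.NonDependent.Propositional using (_×-↔_)
open import Data.Sum using (_⊎_; inj₁; inj₂; [_,_]′)
open import Data.Sum.Function.Propositional using (_⊎-↔_)
open import Data.Vec using (Vec; []; _∷_; toList)
open import Data.Vec.Properties using (length-toList)
import Data.Vec.Relation.Unary.All.Properties as VecAll
import Data.Vec.Relation.Unary.Any.Properties as VecAny
open import Function.Bundles using (_↔_; mk↔ₛ′; _⇔_; mk⇔; Equivalence)
open import Function.Properties.Inverse using (↔-refl; ↔-sym; ↔-trans)
open import Relation.Binary.Definitions using (tri<; tri≈; tri>)
open import Relation.Binary.PropositionalEquality
open import Relation.Nullary using (¬_; ¬?; yes; no)
open import Relation.Nullary.Decidable using (dec-true; dec-false; recompute)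

open ≡-Reasoning

Fin-cong : ∀ {m n} → m ≡ n → Fin m ↔ Fin n
Fin-cong refl = ↔-refl

¬⇒↔Fin0 : ∀ {A : Set} → ¬ A → A ↔ Fin 0
¬⇒↔Fin0 ¬a = mk↔ₛ′ (λ a → ⊥-elim-irr (¬a a)) (λ ()) (λ ()) (λ a → ⊥-elim-irr (¬a a))

Σ-Fin-suc-↔ : ∀ {m} (P : Fin (suc m) → Set) → Σ (Fin (suc m)) P ↔ (P zero ⊎ Σ (Fin m) (λ i → P (suc i)))
Σ-Fin-suc-↔ P = mk↔ₛ′
  (λ { (zero , p) → inj₁ p ; (suc i , p) → inj₂ (i , p) })
  (λ { (inj₁ p) → zero , p ; (inj₂ (i , p)) → suc i , p })
  (λ { (inj₁ p) → refl ; (inj₂ (i , p)) → refl })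
  (λ { (zero , p) → refl ; (suc i , p) → refl })

Σ-Fin-↔ : ∀ m {P : Fin m → Set} (g : ℕ → ℕ) → (∀ i → P i ↔ Fin (g (toℕ i))) →
          Σ (Fin m) P ↔ Fin (sum (applyUpTo g m))
Σ-Fin-↔ zero    g h = ¬⇒↔Fin0 (λ { (() , _) })
Σ-Fin-↔ (suc m) {P} g h = ↔-trans (Σ-Fin-suc-↔ P)
  (↔-trans (h zero ⊎-↔ Σ-Fin-↔ m (λ i → g (suc i)) (λ i → h (suc i))) (↔-sym +↔⊎))

-- Subsets of a given size

trues : List Bool → ℕ
trues []          = 0
trues (true ∷ b)  = suc (trues b)
trues (false ∷ b) = trues b

trues≤length : ∀ m → trues m ≤ length m
trues≤length []          = z≤n
trues≤length (true ∷ m)  = s≤s (trues≤length m)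
trues≤length (false ∷ m) = m≤n⇒m≤1+n (trues≤length m)

record Mask (n c : ℕ) : Set where
  constructor mask
  field
    bits       : List Bool
    .length≡n  : length bits ≡ n
    .trues≡c   : trues bits ≡ c

Mask-↔ : ∀ n c → Mask n c ↔ Fin (n C c)
Mask-↔ zero zero = mk↔ₛ′ (λ _ → zero) (λ _ → mask [] refl refl) (λ { zero → refl })
  (λ { (mask [] _ _) → refl ; (mask (_ ∷ _) () _) })
Mask-↔ zero (suc c) = ¬⇒↔Fin0 λ { (mask [] _ ()) ; (mask (_ ∷ _) () _) }
Mask-↔ (suc n) zero = ↔-trans (mk↔ₛ′ drop (λ (mask b l t) → mask (false ∷ b) (cong suc l) t)
  (λ _ → refl) (λ { (mask (false ∷ b) _ _) → refl ; (mask (true ∷ _) _ ()) ; (mask [] () _) }))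
  (Mask-↔ n zero)
  where
  drop : Mask (suc n) zero → Mask n zero
  drop (mask (false ∷ b) l t) = mask b (suc-injective l) t
  drop (mask (true ∷ _) _ ())
  drop (mask [] () _)
Mask-↔ (suc n) (suc c) = ↔-trans (mk↔ₛ′ uncons cons (λ { (inj₁ _) → refl ; (inj₂ _) → refl })
  (λ { (mask (true ∷ _) _ _) → refl ; (mask (false ∷ _) _ _) → refl ; (mask [] () _) }))
  (↔-trans (Mask-↔ n c ⊎-↔ Mask-↔ n (suc c))
  (↔-trans (↔-sym +↔⊎) (Fin-cong (nCk+nC[k+1]≡[n+1]C[k+1] n c))))
  where
  uncons : Mask (suc n) (suc c) → Mask n c ⊎ Mask n (suc c)
  uncons (mask (true ∷ b) l t)  = inj₁ (mask b (suc-injective l) (suc-injective t))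
  uncons (mask (false ∷ b) l t) = inj₂ (mask b (suc-injective l) t)
  uncons (mask [] () _)
  cons : Mask n c ⊎ Mask n (suc c) → Mask (suc n) (suc c)
  cons (inj₁ (mask b l t)) = mask (true ∷ b) (cong suc l) (cong suc t)
  cons (inj₂ (mask b l t)) = mask (false ∷ b) (cong suc l) t

χ : Bool → ℕ
χ true  = 1
χ false = 0

countᵇ : (ℕ → Bool) → List ℕ → ℕ
countᵇ f []      = 0
countᵇ f (x ∷ l) = χ (f x) + countᵇ f l

occurrences : ℕ → List ℕ → ℕ
occurrences x = countᵇ (x ≡ᵇ_)

below : ℕ → List ℕ → ℕ
below v = countᵇ (_<ᵇ v)

module _ {x y : ℕ} where
  ≡ᵇ-true : x ≡ y → (x ≡ᵇ y) ≡ true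
  ≡ᵇ-true = dec-true (x ≟ y)

  ≡ᵇ-false : x ≢ y → (x ≡ᵇ y) ≡ false
  ≡ᵇ-false = dec-false (x ≟ y)

  ≡ᵇ-true⁻ : (x ≡ᵇ y) ≡ true → x ≡ y
  ≡ᵇ-true⁻ e = ≡ᵇ⇒≡ x y (subst T (sym e) _)

  <ᵇ-true : x < y → (x <ᵇ y) ≡ true
  <ᵇ-true = dec-true (x <? y)

  <ᵇ-false : ¬ x < y → (x <ᵇ y) ≡ false
  <ᵇ-false = dec-false (x <? y)

  <ᵇ-true⁻ : (x <ᵇ y) ≡ true → x < y
  <ᵇ-true⁻ e = <ᵇ⇒< x y (subst T (sym e) _)

≡ᵇ-+ : ∀ c a b → (c + a ≡ᵇ c + b) ≡ (a ≡ᵇ b)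
≡ᵇ-+ zero    a b = refl
≡ᵇ-+ (suc c) a b = ≡ᵇ-+ c a b

<ᵇ-+ : ∀ c a b → (c + a <ᵇ c + b) ≡ (a <ᵇ b)
<ᵇ-+ zero    a b = refl
<ᵇ-+ (suc c) a b = <ᵇ-+ c a b

countᵇ-cong : ∀ {f g} l → (∀ x → f x ≡ g x) → countᵇ f l ≡ countᵇ g l
countᵇ-cong []      f≡g = refl
countᵇ-cong (x ∷ l) f≡g = cong₂ _+_ (cong χ (f≡g x)) (countᵇ-cong l f≡g)

countᵇ-split₃ : ∀ {f g h k} l → (∀ x → x ∈ l → χ (f x) ≡ χ (g x) + χ (h x) + χ (k x)) →
                countᵇ f l ≡ countᵇ g l + countᵇ h l + countᵇ k l
countᵇ-split₃ [] H = refl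
countᵇ-split₃ {f} {g} {h} {k} (x ∷ l) H =
  trans (cong₂ _+_ (H x (here refl)) (countᵇ-split₃ l (λ y m → H y (there m))))
        (interchange (χ (g x)) (χ (h x)) (χ (k x)) _ _ _)
  where
  open +-*-Solver
  interchange : ∀ a b c A B C → (a + b + c) + (A + B + C) ≡ (a + A) + (b + B) + (c + C)
  interchange = solve 6 (λ a b c A B C → (a :+ b :+ c) :+ (A :+ B :+ C) := (a :+ A) :+ (b :+ B) :+ (c :+ C)) refl

countᵇ-none : ∀ {f} l → (∀ x → x ∈ l → f x ≡ false) → countᵇ f l ≡ 0
countᵇ-none []      h = refl
countᵇ-none (x ∷ l) h rewrite h x (here refl) = countᵇ-none l (λ y m → h y (there m))

countᵇ-mono : ∀ {f g} l → (∀ x → x ∈ l → f x ≡ true → g x ≡ true) → countᵇ f l ≤ countᵇ g l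
countᵇ-mono []      h = z≤n
countᵇ-mono {f} (x ∷ l) h = +-mono-≤ (χ-mono (h x (here refl))) (countᵇ-mono l (λ y m → h y (there m)))
  where
  χ-mono : ∀ {a b} → (a ≡ true → b ≡ true) → χ a ≤ χ b
  χ-mono {false} _ = z≤n
  χ-mono {true}  h rewrite h refl = ≤-refl

countᵇ-pos : ∀ {f x} l → x ∈ l → f x ≡ true → 0 < countᵇ f l
countᵇ-pos (y ∷ l) (here refl) e rewrite e = s≤s z≤n
countᵇ-pos {f} (y ∷ l) (there m) e = ≤-trans (countᵇ-pos l m e) (m≤n+m _ (χ (f y)))

countᵇ-pos⁻ : ∀ {f} l → 0 < countᵇ f l → ∃ λ x → x ∈ l × f x ≡ true
countᵇ-pos⁻ {f} (y ∷ l) p with f y in e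
... | true  = y , here refl , e
... | false = let x , m , q = countᵇ-pos⁻ l p in x , there m , q

countᵇ-+-not : ∀ f l → countᵇ f l + countᵇ (λ x → not (f x)) l ≡ length l
countᵇ-+-not f []      = refl
countᵇ-+-not f (x ∷ l) with f x
... | true  = cong suc (countᵇ-+-not f l)
... | false = trans (+-suc (countᵇ f l) _) (cong suc (countᵇ-+-not f l))

countᵇ-map : ∀ f g l → countᵇ f (map g l) ≡ countᵇ (λ x → f (g x)) l
countᵇ-map f g []      = refl
countᵇ-map f g (x ∷ l) = cong (χ (f (g x)) +_) (countᵇ-map f g l)

occurrences-pos : ∀ {x} l → x ∈ l → 0 < occurrences x l
occurrences-pos {x} l m = countᵇ-pos l m (≡ᵇ-true {x} refl)

occurrences-pos⁻ : ∀ {x} l → 0 < occurrences x l → x ∈ l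
occurrences-pos⁻ l p with countᵇ-pos⁻ l p
... | y , m , e = subst (_∈ l) (sym (≡ᵇ-true⁻ e)) m

without : ℕ → List ℕ → List ℕ
without x = filter (λ y → ¬? (x ≟ y))

distinct : List ℕ → ℕ
distinct l = length (deduplicate _≟_ l)

without-≡ : ∀ x l → without x (x ∷ l) ≡ without x l
without-≡ x l = filter-reject (λ y → ¬? (x ≟ y)) (λ x≢x → x≢x refl)

without-≢ : ∀ {x y} l → x ≢ y → without x (y ∷ l) ≡ y ∷ without x l
without-≢ {x} l = filter-accept (λ y → ¬? (x ≟ y))

without-comm : ∀ x y l → without x (without y l) ≡ without y (without x l)
without-comm x y [] = refl
without-comm x y (z ∷ l) with x ≟ z | y ≟ z
... | yes refl | yes refl = refl
... | yes refl | no y≢z = begin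
  without x (without y (x ∷ l)) ≡⟨ cong (without x) (without-≢ l y≢z) ⟩
  without x (x ∷ without y l)   ≡⟨ without-≡ x _ ⟩
  without x (without y l)       ≡⟨ without-comm x y l ⟩
  without y (without x l)       ≡⟨ cong (without y) (without-≡ x l) ⟨
  without y (without x (x ∷ l)) ∎
... | no x≢z | yes refl = begin
  without x (without y (y ∷ l)) ≡⟨ cong (without x) (without-≡ y l) ⟩
  without x (without y l)       ≡⟨ without-comm x y l ⟩
  without y (without x l)       ≡⟨ without-≡ y _ ⟨
  without y (y ∷ without x l)   ≡⟨ cong (without y) (without-≢ l x≢z) ⟨
  without y (without x (y ∷ l)) ∎
... | no x≢z | no y≢z = begin
  without x (without y (z ∷ l)) ≡⟨ cong (without x) (without-≢ l y≢z) ⟩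
  without x (z ∷ without y l)   ≡⟨ without-≢ _ x≢z ⟩
  z ∷ without x (without y l)   ≡⟨ cong (z ∷_) (without-comm x y l) ⟩
  z ∷ without y (without x l)   ≡⟨ without-≢ _ y≢z ⟨
  without y (z ∷ without x l)   ≡⟨ cong (without y) (without-≢ l x≢z) ⟨
  without y (without x (z ∷ l)) ∎

length-without+occurrences : ∀ x l → length (without x l) + occurrences x l ≡ length l
length-without+occurrences x [] = refl
length-without+occurrences x (y ∷ l) with x ≟ y
... | yes refl rewrite without-≡ x l | ≡ᵇ-true {x} {x} refl =
  trans (+-suc _ _) (cong suc (length-without+occurrences x l))
... | no x≢y rewrite without-≢ l x≢y | ≡ᵇ-false x≢y = cong suc (length-without+occurrences x l)

deduplicate-without : ∀ x l → deduplicate _≟_ (without x l) ≡ without x (deduplicate _≟_ l)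
deduplicate-without x [] = refl
deduplicate-without x (y ∷ l) with x ≟ y
... | yes refl = begin
  deduplicate _≟_ (without x (x ∷ l))              ≡⟨ cong (deduplicate _≟_) (without-≡ x l) ⟩
  deduplicate _≟_ (without x l)                    ≡⟨ deduplicate-without x l ⟩
  without x (deduplicate _≟_ l)                    ≡⟨ filter-idem (λ y → ¬? (x ≟ y)) (deduplicate _≟_ l) ⟨
  without x (without x (deduplicate _≟_ l))        ≡⟨ without-≡ x _ ⟨
  without x (x ∷ without x (deduplicate _≟_ l))    ∎
... | no x≢y = begin
  deduplicate _≟_ (without x (y ∷ l))              ≡⟨ cong (deduplicate _≟_) (without-≢ l x≢y) ⟩
  y ∷ without y (deduplicate _≟_ (without x l))    ≡⟨ cong (λ d → y ∷ without y d) (deduplicate-without x l) ⟩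
  y ∷ without y (without x (deduplicate _≟_ l))    ≡⟨ cong (y ∷_) (without-comm y x (deduplicate _≟_ l)) ⟩
  y ∷ without x (without y (deduplicate _≟_ l))    ≡⟨ without-≢ _ x≢y ⟨
  without x (y ∷ without y (deduplicate _≟_ l))    ∎

length-without-unique : ∀ {x ys} → Unique ys → x ∈ ys → length ys ≡ suc (length (without x ys))
length-without-unique {x} (y∉ys ∷ u) (here refl) =
  cong (λ ys → suc (length ys)) (sym (trans (without-≡ x _) (filter-all (λ y → ¬? (x ≟ y)) y∉ys)))
length-without-unique {x} {y ∷ ys} (y∉ys ∷ u) (there x∈ys) =
  cong suc (trans (length-without-unique u x∈ys) (cong length (sym (without-≢ ys x≢y))))
  where
  x≢y : x ≢ y
  x≢y x≡y = lookup y∉ys x∈ys (sym x≡y)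

distinct-without : ∀ {x} l → x ∈ l → distinct l ≡ suc (distinct (without x l))
distinct-without {x} l x∈l = trans (length-without-unique (deduplicate-! l) (∈-deduplicate⁺ _≟_ x∈l))
                                   (cong (λ d → suc (length d)) (sym (deduplicate-without x l)))

module _ {f : ℕ → ℕ} (f-injective : ∀ {x y} → f x ≡ f y → x ≡ y) where

  without-map : ∀ x l → without (f x) (map f l) ≡ map f (without x l)
  without-map x [] = refl
  without-map x (y ∷ l) with x ≟ y
  ... | yes refl = trans (without-≡ (f x) _) (trans (without-map x l) (cong (map f) (sym (without-≡ x l))))
  ... | no x≢y   = trans (without-≢ _ (λ e → x≢y (f-injective e)))
                         (trans (cong (f y ∷_) (without-map x l)) (cong (map f) (sym (without-≢ l x≢y))))

  deduplicate-map : ∀ l → deduplicate _≟_ (map f l) ≡ map f (deduplicate _≟_ l)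
  deduplicate-map []      = refl
  deduplicate-map (y ∷ l) = cong (f y ∷_) (trans (cong (without (f y)) (deduplicate-map l)) (without-map y (deduplicate _≟_ l)))

  distinct-map : ∀ l → distinct (map f l) ≡ distinct l
  distinct-map l = trans (cong length (deduplicate-map l)) (length-map f (deduplicate _≟_ l))

-- Ranked lists

Ranked : List ℕ → Set
Ranked l = ∀ x → x ∈ l → x ≡ suc (below x l)

ranked-positive : ∀ {x l} → Ranked l → x ∈ l → 1 ≤ x
ranked-positive {x} R x∈l = subst (1 ≤_) (sym (R x x∈l)) (s≤s z≤n)

ranked⇒positive : ∀ {l} → Ranked l → All (1 ≤_) l
ranked⇒positive R = tabulate (ranked-positive R)

GapBetween : List ℕ → ℕ → ℕ → Set
GapBetween l u v = ∀ z → u < z → z < v → occurrences z l ≡ 0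

NextValue : (ℕ → ℕ) → Set
NextValue mult = ∀ x y → 0 < mult x → 0 < mult y → x < y →
                 (∀ z → x < z → z < y → mult z ≡ 0) → y ≡ x + mult x

NextValue-cong : ∀ {f g} → (∀ x → f x ≡ g x) → NextValue f → NextValue g
NextValue-cong f≡g next x y px py x<y gap =
  trans (next x y (subst (0 <_) (sym (f≡g x)) px) (subst (0 <_) (sym (f≡g y)) py) x<y
              (λ z x<z z<y → trans (f≡g z) (gap z x<z z<y)))
        (cong (x +_) (f≡g x))

below-across-gap : ∀ {u v} l → u < v → GapBetween l u v → below v l ≡ below u l + occurrences u l
below-across-gap {u} {v} l u<v gap = begin
  below v l                                           ≡⟨ countᵇ-split₃ l split ⟩
  below u l + occurrences u l + countᵇ between l      ≡⟨ cong (below u l + occurrences u l +_) (countᵇ-none l nothing-between) ⟩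
  below u l + occurrences u l + 0                     ≡⟨ +-identityʳ _ ⟩
  below u l + occurrences u l                         ∎
  where
  between : ℕ → Bool
  between b = (u <ᵇ b) ∧ (b <ᵇ v)
  split : ∀ b → b ∈ l → χ (b <ᵇ v) ≡ χ (b <ᵇ u) + χ (u ≡ᵇ b) + χ (between b)
  split b _ with <-cmp b u
  ... | tri< b<u _ _ rewrite <ᵇ-true (<-trans b<u u<v) | <ᵇ-true b<u | ≡ᵇ-false {u} {b} (≢-sym (<⇒≢ b<u))
                           | <ᵇ-false {u} {b} (<-asym b<u) = refl
  ... | tri≈ _ refl _ rewrite <ᵇ-true u<v | <ᵇ-false {u} {u} (<-irrefl refl) | ≡ᵇ-true {u} {u} refl = refl
  ... | tri> _ _ u<b rewrite <ᵇ-false {b} {u} (<-asym u<b) | ≡ᵇ-false {u} {b} (<⇒≢ u<b) | <ᵇ-true u<b = refl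
  nothing-between : ∀ b → b ∈ l → between b ≡ false
  nothing-between b b∈l with u <ᵇ b in u<b | b <ᵇ v in b<v
  ... | true  | true  = ⊥-elim (<-irrefl (sym (gap b (<ᵇ-true⁻ u<b) (<ᵇ-true⁻ b<v))) (occurrences-pos l b∈l))
  ... | true  | false = refl
  ... | false | _     = refl

ranked⇒next : ∀ {l} → Ranked l → NextValue (λ x → occurrences x l)
ranked⇒next {l} R x y px py x<y gap = begin
  y                                 ≡⟨ R y (occurrences-pos⁻ l py) ⟩
  suc (below y l)                   ≡⟨ cong suc (below-across-gap l x<y gap) ⟩
  suc (below x l) + occurrences x l ≡⟨ cong (_+ occurrences x l) (R x (occurrences-pos⁻ l px)) ⟨
  x + occurrences x l               ∎

vanishing-below-suc : ∀ {l v z} → occurrences v l ≡ 0 → (z < v → occurrences z l ≡ 0) → z < suc v → occurrences z l ≡ 0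
vanishing-below-suc {l} occ-v h z≤v with m≤n⇒m<n∨m≡n (s≤s⁻¹ z≤v)
... | inj₁ z<v  = h z<v
... | inj₂ refl = occ-v

largestValueBelow : ∀ l v → (∃ λ u → u < v × 0 < occurrences u l × GapBetween l u v)
                          ⊎ (∀ z → z < v → occurrences z l ≡ 0)
largestValueBelow l zero = inj₂ (λ _ ())
largestValueBelow l (suc v) with occurrences v l in occ-v
... | suc _ = inj₁ (v , ≤-refl , subst (0 <_) (sym occ-v) (s≤s z≤n) ,
                   λ z v<z z≤v → ⊥-elim (<-irrefl refl (<-≤-trans v<z (s≤s⁻¹ z≤v))))
... | zero with largestValueBelow l v
...   | inj₁ (u , u<v , pu , gap) = inj₁ (u , m<n⇒m<1+n u<v , pu , λ z u<z → vanishing-below-suc {l} occ-v (gap z u<z))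
...   | inj₂ none                 = inj₂ λ z → vanishing-below-suc {l} occ-v (none z)

next⇒ranked : ∀ {l} → (∀ x → x ∈ l → 1 ≤ x) → 1 ∈ l → NextValue (λ x → occurrences x l) → Ranked l
next⇒ranked {l} positive 1∈l next x x∈l = <-rec P step x (occurrences-pos l x∈l)
  where
  P : ℕ → Set
  P v = 0 < occurrences v l → v ≡ suc (below v l)
  step : ∀ v → (∀ {u} → u < v → P u) → P v
  step v rec pv with largestValueBelow l v
  ... | inj₁ (u , u<v , pu , gap) = begin
    v                                   ≡⟨ next u v pu pv u<v gap ⟩
    u + occurrences u l                 ≡⟨ cong (_+ occurrences u l) (rec u<v pu) ⟩
    suc (below u l + occurrences u l)   ≡⟨ cong suc (below-across-gap l u<v gap) ⟨
    suc (below v l)                     ∎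
  ... | inj₂ none = trans v≡1 (cong suc (sym nothing-below))
    where
    absent : ∀ {b} → b ∈ l → ¬ b < v
    absent b∈l b<v = <-irrefl (sym (none _ b<v)) (occurrences-pos l b∈l)
    v≡1 : v ≡ 1
    v≡1 = ≤-antisym (≮⇒≥ (absent 1∈l)) (positive v (occurrences-pos⁻ l pv))
    nothing-below : below v l ≡ 0
    nothing-below = countᵇ-none l (λ b b∈l → <ᵇ-false (absent b∈l))

ranked⇒1∈ : ∀ {x l} → Ranked (x ∷ l) → 1 ∈ x ∷ l
ranked⇒1∈ {x} {l} R = subst (_∈ x ∷ l) m≡1 m∈
  where
  m : ℕ
  m = min x l
  m∈ : m ∈ x ∷ l
  m∈ = [ (λ m≡x → subst (_∈ x ∷ l) (sym m≡x) (here refl)) , there ]′ (argmin-sel (λ y → y) x l)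
  m≤ : ∀ b → b ∈ x ∷ l → m ≤ b
  m≤ b (here refl) = min≤⊤ x l
  m≤ b (there b∈l) = lookup (min≤xs x l) b∈l
  m≡1 : m ≡ 1
  m≡1 = trans (R m m∈) (cong suc (countᵇ-none (x ∷ l) (λ b b∈ → <ᵇ-false (≤⇒≯ (m≤ b b∈)))))

ranked-ones-positive : ∀ {l k} → Ranked l → distinct l ≡ suc k → 1 ≤ occurrences 1 l
ranked-ones-positive {x ∷ l} R _ = occurrences-pos (x ∷ l) (ranked⇒1∈ R)

ranked⇒≤length : ∀ {x l} → Ranked l → x ∈ l → x ≤ length l
ranked⇒≤length {x} {l} R x∈l =
  subst₂ _≤_ (sym (trans (R x x∈l) (+-comm 1 _))) (countᵇ-+-not (_<ᵇ x) l)
    (+-monoʳ-≤ (below x l) (countᵇ-pos l x∈l (cong not (<ᵇ-false {x} (<-irrefl refl)))))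

-- Splitting off the first block

interleave : List Bool → ℕ → List ℕ → List ℕ
interleave []          c r       = map (c +_) r
interleave (true ∷ m)  c r       = 1 ∷ interleave m c r
interleave (false ∷ m) c []      = interleave m c []
interleave (false ∷ m) c (y ∷ r) = c + y ∷ interleave m c r

onesMask : List ℕ → List Bool
onesMask = map (1 ≡ᵇ_)

lower : ℕ → List ℕ → List ℕ
lower c l = map (_∸ c) (without 1 l)

countᵇ-interleave : ∀ f m c r → countᵇ f (interleave m c r) ≡ trues m * χ (f 1) + countᵇ (λ y → f (c + y)) r
countᵇ-interleave f [] c r = countᵇ-map f (c +_) r
countᵇ-interleave f (true ∷ m) c r =
  trans (cong (χ (f 1) +_) (countᵇ-interleave f m c r)) (sym (+-assoc (χ (f 1)) _ _))
countᵇ-interleave f (false ∷ m) c [] = countᵇ-interleave f m c []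
countᵇ-interleave f (false ∷ m) c (y ∷ r) =
  trans (cong (χ (f (c + y)) +_) (countᵇ-interleave f m c r)) (x∙yz≈y∙xz (χ (f (c + y))) (trues m * χ (f 1)) _)

length-interleave : ∀ m c r → length (interleave m c r) ≡ trues m + length r
length-interleave []          c r       = length-map (c +_) r
length-interleave (true ∷ m)  c r       = cong suc (length-interleave m c r)
length-interleave (false ∷ m) c []      = length-interleave m c []
length-interleave (false ∷ m) c (y ∷ r) = trans (cong suc (length-interleave m c r)) (sym (+-suc (trues m) (length r)))

∈-interleave⁻ : ∀ {x} m c r → x ∈ interleave m c r → x ≡ 1 ⊎ ∃ λ y → y ∈ r × x ≡ c + y
∈-interleave⁻ []          c r       x∈ = inj₂ (∈-map⁻ (c +_) x∈)
∈-interleave⁻ (true ∷ m)  c r       (here x≡1) = inj₁ x≡1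
∈-interleave⁻ (true ∷ m)  c r       (there x∈) = ∈-interleave⁻ m c r x∈
∈-interleave⁻ (false ∷ m) c []      x∈ = ∈-interleave⁻ m c [] x∈
∈-interleave⁻ (false ∷ m) c (y ∷ r) (here x≡c+y) = inj₂ (y , here refl , x≡c+y)
∈-interleave⁻ (false ∷ m) c (y ∷ r) (there x∈) with ∈-interleave⁻ m c r x∈
... | inj₁ x≡1              = inj₁ x≡1
... | inj₂ (z , z∈r , x≡c+z) = inj₂ (z , there z∈r , x≡c+z)

∈-interleave⁺ : ∀ {y} m c r → y ∈ r → c + y ∈ interleave m c r
∈-interleave⁺ []          c r       y∈r         = ∈-map⁺ (c +_) y∈r
∈-interleave⁺ (true ∷ m)  c r       y∈r         = there (∈-interleave⁺ m c r y∈r)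
∈-interleave⁺ (false ∷ m) c (z ∷ r) (here refl) = here refl
∈-interleave⁺ (false ∷ m) c (z ∷ r) (there y∈r) = there (∈-interleave⁺ m c r y∈r)

1∈interleave : ∀ m c r → 0 < trues m → 1 ∈ interleave m c r
1∈interleave (true ∷ m)  c r       _ = here refl
1∈interleave (false ∷ m) c []      p = 1∈interleave m c [] p
1∈interleave (false ∷ m) c (y ∷ r) p = there (1∈interleave m c r p)

1≢+ : ∀ {c y} → 1 ≤ c → 1 ≤ y → 1 ≢ c + y
1≢+ {suc c} {suc y} _ _ 1≡ = 0≢1+n (trans (suc-injective 1≡) (+-suc c y))

without1-interleave : ∀ m {c r} → 1 ≤ c → All (1 ≤_) r → without 1 (interleave m c r) ≡ map (c +_) r
without1-interleave [] c≥1 [] = refl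
without1-interleave [] c≥1 (y≥1 ∷ r≥1) =
  trans (without-≢ _ (1≢+ c≥1 y≥1)) (cong (_ ∷_) (without1-interleave [] c≥1 r≥1))
without1-interleave (true ∷ m) {c} {r} c≥1 r≥1 = trans (without-≡ 1 (interleave m c r)) (without1-interleave m c≥1 r≥1)
without1-interleave (false ∷ m) c≥1 [] = without1-interleave m c≥1 []
without1-interleave (false ∷ m) c≥1 (y≥1 ∷ r≥1) =
  trans (without-≢ _ (1≢+ c≥1 y≥1)) (cong (_ ∷_) (without1-interleave m c≥1 r≥1))

lower-interleave : ∀ m {c r} → 1 ≤ c → All (1 ≤_) r → lower c (interleave m c r) ≡ r
lower-interleave m {c} {r} c≥1 r≥1 = trans (cong (map (_∸ c)) (without1-interleave m c≥1 r≥1)) (lower-shift r)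
  where
  lower-shift : ∀ r → map (_∸ c) (map (c +_) r) ≡ r
  lower-shift []      = refl
  lower-shift (y ∷ r) = cong₂ _∷_ (m+n∸m≡n c y) (lower-shift r)

onesMask-interleave : ∀ m {c r} → length m ≡ trues m + length r → 1 ≤ c → All (1 ≤_) r →
                      onesMask (interleave m c r) ≡ m
onesMask-interleave []          {r = []}    _   _   _ = refl
onesMask-interleave (true ∷ m)  len c≥1 r≥1 = cong (true ∷_) (onesMask-interleave m (suc-injective len) c≥1 r≥1)
onesMask-interleave (false ∷ m) {r = []} len _ _ =
  ⊥-elim (<-irrefl (sym (trans len (+-identityʳ _))) (s≤s (trues≤length m)))
onesMask-interleave (false ∷ m) {r = _ ∷ r} len c≥1 (y≥1 ∷ r≥1) =
  cong₂ _∷_ (≡ᵇ-false (1≢+ c≥1 y≥1)) (onesMask-interleave m (suc-injective (trans len (+-suc _ _))) c≥1 r≥1)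

interleave-onesMask-lower : ∀ c l → (∀ x → x ∈ l → x ≢ 1 → c ≤ x) → interleave (onesMask l) c (lower c l) ≡ l
interleave-onesMask-lower c []      _ = refl
interleave-onesMask-lower c (x ∷ l) large with 1 ≟ x
... | yes refl = trans (cong (λ r → 1 ∷ interleave (onesMask l) c (map (_∸ c) r)) (without-≡ 1 l))
                       (cong (1 ∷_) (interleave-onesMask-lower c l (λ y y∈l → large y (there y∈l))))
... | no 1≢x rewrite ≡ᵇ-false 1≢x =
  cong₂ _∷_ (m+[n∸m]≡n (large x (here refl) (≢-sym 1≢x)))
            (interleave-onesMask-lower c l (λ y y∈l → large y (there y∈l)))

trues-onesMask : ∀ l → trues (onesMask l) ≡ occurrences 1 l
trues-onesMask [] = refl
trues-onesMask (x ∷ l) with 1 ≟ x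
... | yes refl = cong suc (trues-onesMask l)
... | no 1≢x rewrite ≡ᵇ-false 1≢x = trues-onesMask l

length-lower : ∀ l → length (lower (occurrences 1 l) l) ≡ length l ∸ occurrences 1 l
length-lower l = begin
  length (map (_∸ occurrences 1 l) (without 1 l))          ≡⟨ length-map (_∸ occurrences 1 l) (without 1 l) ⟩
  length (without 1 l)                                     ≡⟨ m+n∸n≡m (length (without 1 l)) (occurrences 1 l) ⟨
  length (without 1 l) + occurrences 1 l ∸ occurrences 1 l ≡⟨ cong (_∸ occurrences 1 l) (length-without+occurrences 1 l) ⟩
  length l ∸ occurrences 1 l                               ∎

module _ (m : List Bool) {c : ℕ} (r : List ℕ) (c≥1 : 1 ≤ c) where

  occurrences-interleave-1 : All (1 ≤_) r → occurrences 1 (interleave m c r) ≡ trues m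
  occurrences-interleave-1 r≥1 = begin
    occurrences 1 (interleave m c r)               ≡⟨ countᵇ-interleave (1 ≡ᵇ_) m c r ⟩
    trues m * 1 + countᵇ (λ y → 1 ≡ᵇ c + y) r    ≡⟨ cong₂ _+_ (*-identityʳ (trues m)) (countᵇ-none r no-shifted-one) ⟩
    trues m + 0                                    ≡⟨ +-identityʳ _ ⟩
    trues m                                        ∎
    where
    no-shifted-one : ∀ y → y ∈ r → (1 ≡ᵇ c + y) ≡ false
    no-shifted-one y y∈r = ≡ᵇ-false (1≢+ c≥1 (lookup r≥1 y∈r))

  occurrences-interleave : ∀ {y} → 1 ≤ y → occurrences (c + y) (interleave m c r) ≡ occurrences y r
  occurrences-interleave {y} y≥1 = begin
    occurrences (c + y) (interleave m c r)                       ≡⟨ countᵇ-interleave (c + y ≡ᵇ_) m c r ⟩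
    trues m * χ (c + y ≡ᵇ 1) + countᵇ (λ z → c + y ≡ᵇ c + z) r ≡⟨ cong₂ _+_ no-ones (countᵇ-cong r (≡ᵇ-+ c y)) ⟩
    0 + occurrences y r                                          ∎
    where
    no-ones : trues m * χ (c + y ≡ᵇ 1) ≡ 0
    no-ones rewrite ≡ᵇ-false (≢-sym (1≢+ c≥1 y≥1)) = *-zeroʳ (trues m)

  below-interleave-1 : below 1 (interleave m c r) ≡ 0
  below-interleave-1 = trans (countᵇ-interleave (_<ᵇ 1) m c r) (cong₂ _+_ (*-zeroʳ (trues m)) (countᵇ-none r above-1))
    where
    above-1 : ∀ y → y ∈ r → (c + y <ᵇ 1) ≡ false
    above-1 y _ = <ᵇ-false (≤⇒≯ (≤-trans c≥1 (m≤m+n c y)))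

  below-interleave : ∀ {y} → 1 ≤ y → below (c + y) (interleave m c r) ≡ trues m + below y r
  below-interleave {y} y≥1 = begin
    below (c + y) (interleave m c r)                             ≡⟨ countᵇ-interleave (_<ᵇ c + y) m c r ⟩
    trues m * χ (1 <ᵇ c + y) + countᵇ (λ z → c + z <ᵇ c + y) r ≡⟨ cong₂ _+_ all-ones (countᵇ-cong r (λ z → <ᵇ-+ c z y)) ⟩
    trues m + below y r                                          ∎
    where
    all-ones : trues m * χ (1 <ᵇ c + y) ≡ trues m
    all-ones rewrite <ᵇ-true (+-mono-≤ c≥1 y≥1) = *-identityʳ (trues m)

blockSize   : List ℕ → ℕ → ℕ
blockOffset : List ℕ → ℕ → ℕ
blockSize l i = occurrences (suc (blockOffset l i)) l
blockOffset l zero    = 0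
blockOffset l (suc i) = blockOffset l i + blockSize l i

BlockBounded : (ℕ → ℕ) → List ℕ → Set
BlockBounded s l = ∀ i → i < distinct l → blockSize l i ≤ s i

module _ (m : List Bool) {c : ℕ} (r : List ℕ) (trues≡c : trues m ≡ c) (c≥1 : 1 ≤ c) (r≥1 : All (1 ≤_) r) where
  private
    L : List ℕ
    L = interleave m c r

  ranked-interleave : Ranked r → Ranked L
  ranked-interleave R x x∈ with ∈-interleave⁻ m c r x∈
  ... | inj₁ refl = cong suc (sym (below-interleave-1 m r c≥1))
  ... | inj₂ (y , y∈r , refl) = begin
    c + y                                 ≡⟨ cong (c +_) (R y y∈r) ⟩
    c + suc (below y r)                   ≡⟨ +-suc c _ ⟩
    suc (c + below y r)                   ≡⟨ cong (λ k → suc (k + below y r)) trues≡c ⟨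
    suc (trues m + below y r)             ≡⟨ cong suc (below-interleave m r c≥1 (lookup r≥1 y∈r)) ⟨
    suc (below (c + y) L)                 ∎

  ranked-interleave⁻ : Ranked L → Ranked r
  ranked-interleave⁻ R y y∈r = +-cancelˡ-≡ c _ _ (begin
    c + y                                  ≡⟨ R (c + y) (∈-interleave⁺ m c r y∈r) ⟩
    suc (below (c + y) L)                  ≡⟨ cong suc (below-interleave m r c≥1 (lookup r≥1 y∈r)) ⟩
    suc (trues m + below y r)              ≡⟨ cong (λ k → suc (k + below y r)) trues≡c ⟩
    suc (c + below y r)                    ≡⟨ +-suc c _ ⟨
    c + suc (below y r)                    ∎)

  blockSize-interleave-zero : blockSize L 0 ≡ c
  blockSize-interleave-zero = trans (occurrences-interleave-1 m r c≥1 r≥1) trues≡c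

  blockOffset-interleave : ∀ i → blockOffset L (suc i) ≡ c + blockOffset r i
  blockSize-interleave   : ∀ i → blockSize L (suc i) ≡ blockSize r i
  blockOffset-interleave zero    = trans blockSize-interleave-zero (sym (+-identityʳ c))
  blockOffset-interleave (suc i) = trans (cong₂ _+_ (blockOffset-interleave i) (blockSize-interleave i)) (+-assoc c _ _)
  blockSize-interleave i = begin
    occurrences (suc (blockOffset L (suc i))) L    ≡⟨ cong (λ o → occurrences (suc o) L) (blockOffset-interleave i) ⟩
    occurrences (suc (c + blockOffset r i)) L      ≡⟨ cong (λ o → occurrences o L) (+-suc c _) ⟨
    occurrences (c + suc (blockOffset r i)) L      ≡⟨ occurrences-interleave m r c≥1 (s≤s z≤n) ⟩
    blockSize r i                                  ∎

  distinct-interleave : distinct L ≡ suc (distinct r)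
  distinct-interleave = begin
    distinct L                        ≡⟨ distinct-without L (1∈interleave m c r (subst (0 <_) (sym trues≡c) c≥1)) ⟩
    suc (distinct (without 1 L))      ≡⟨ cong (λ l → suc (distinct l)) (without1-interleave m c≥1 r≥1) ⟩
    suc (distinct (map (c +_) r))     ≡⟨ cong suc (distinct-map (+-cancelˡ-≡ c _ _) r) ⟩
    suc (distinct r)                  ∎

  blockBounded-interleave : ∀ s → c ≤ s 0 → BlockBounded (λ i → s (suc i)) r → BlockBounded s L
  blockBounded-interleave s c≤s₀ B zero    _ = subst (_≤ s 0) (sym blockSize-interleave-zero) c≤s₀
  blockBounded-interleave s c≤s₀ B (suc i) i<d =
    subst (_≤ s (suc i)) (sym (blockSize-interleave i)) (B i (s≤s⁻¹ (subst (suc i <_) distinct-interleave i<d)))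

  blockBounded-interleave⁻ : ∀ s → BlockBounded s L → c ≤ s 0 × BlockBounded (λ i → s (suc i)) r
  blockBounded-interleave⁻ s B =
    subst (_≤ s 0) blockSize-interleave-zero (B 0 (subst (0 <_) (sym distinct-interleave) (s≤s z≤n))) ,
    λ i i<d → subst (_≤ s (suc i)) (blockSize-interleave i)
                    (B (suc i) (subst (suc i <_) (sym distinct-interleave) (s≤s i<d)))

module _ {l : List ℕ} (R : Ranked l) where
  private
    c : ℕ
    c = occurrences 1 l

  ranked-above-ones : ∀ {x} → x ∈ l → x ≢ 1 → suc c ≤ x
  ranked-above-ones {x} x∈l x≢1 = subst (suc c ≤_) (sym (R x x∈l)) (s≤s (countᵇ-mono l ones-below-x))
    where
    1<x : 1 < x
    1<x = ≤∧≢⇒< (ranked-positive R x∈l) (≢-sym x≢1)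
    ones-below-x : ∀ y → y ∈ l → (1 ≡ᵇ y) ≡ true → (y <ᵇ x) ≡ true
    ones-below-x y _ 1≡y rewrite sym (≡ᵇ-true⁻ {1} {y} 1≡y) = <ᵇ-true 1<x

  lower-positive : All (1 ≤_) (lower c l)
  lower-positive = tabulate positive
    where
    positive : ∀ {y} → y ∈ lower c l → 1 ≤ y
    positive y∈ with ∈-map⁻ (_∸ c) y∈
    ... | x , x∈ , refl with ∈-filter⁻ _ {xs = l} x∈
    ...   | x∈l , 1≢x = subst (_≤ x ∸ c) (m+n∸n≡m 1 c) (∸-monoˡ-≤ c (ranked-above-ones x∈l (≢-sym 1≢x)))

  interleave-ones-lower : interleave (onesMask l) c (lower c l) ≡ l
  interleave-ones-lower = interleave-onesMask-lower c l (λ x x∈l x≢1 → ≤-trans (n≤1+n c) (ranked-above-ones x∈l x≢1))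

  module _ (c≥1 : 1 ≤ c) where
    ranked-lower : Ranked (lower c l)
    ranked-lower = ranked-interleave⁻ (onesMask l) (lower c l) (trues-onesMask l) c≥1 lower-positive
                     (subst Ranked (sym interleave-ones-lower) R)

    blockBounded-lower : ∀ s → BlockBounded s l → c ≤ s 0 × BlockBounded (λ i → s (suc i)) (lower c l)
    blockBounded-lower s B = blockBounded-interleave⁻ (onesMask l) (lower c l) (trues-onesMask l) c≥1 lower-positive s
                               (subst (BlockBounded s) (sym interleave-ones-lower) B)

    distinct-lower : distinct l ≡ suc (distinct (lower c l))
    distinct-lower = trans (cong distinct (sym interleave-ones-lower))
                           (distinct-interleave (onesMask l) (lower c l) (trues-onesMask l) c≥1 lower-positive)

toFin⁺ : ∀ {c m} → .(1 ≤ c) → .(c ≤ m) → Fin m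
toFin⁺ {suc c} _ c<m = fromℕ< c<m

suc-toℕ-toFin⁺ : ∀ {c m} .(c≥1 : 1 ≤ c) .(c≤m : c ≤ m) → suc (toℕ (toFin⁺ c≥1 c≤m)) ≡ c
suc-toℕ-toFin⁺ {suc c} _ c<m = cong suc (toℕ-fromℕ< c<m)

record Ranking (n : ℕ) (s : ℕ → ℕ) (k : ℕ) : Set where
  constructor ranking
  field
    entries     : List ℕ
    .length≡n   : length entries ≡ n
    .ranked     : Ranked entries
    .bounded    : BlockBounded s entries
    .distinct≡k : distinct entries ≡ k

ranking-≡ : ∀ {n s k l l′} .{a b c d a′ b′ c′ d′} → l ≡ l′ →
            ranking {n} {s} {k} l a b c d ≡ ranking l′ a′ b′ c′ d′
ranking-≡ refl = refl

module Decomposition (n : ℕ) (s : ℕ → ℕ) (k : ℕ) where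

  Peeled : Fin (s 0) → Set
  Peeled i = Mask n (suc (toℕ i)) × Ranking (n ∸ suc (toℕ i)) (λ j → s (suc j)) k

  Peeled-≡ : ∀ {i i′ m m′ r r′} .{a b a′ b′ w x y z w′ x′ y′ z′} → i ≡ i′ → m ≡ m′ → r ≡ r′ →
             _≡_ {A = Σ (Fin (s 0)) Peeled} (i , mask m a b , ranking r w x y z)
                                            (i′ , mask m′ a′ b′ , ranking r′ w′ x′ y′ z′)
  Peeled-≡ refl refl refl = refl

  trues+rest≡length : ∀ {c} m → length m ≡ n → trues m ≡ c → c + (n ∸ c) ≡ n
  trues+rest≡length m lm tm = m+[n∸m]≡n (subst₂ _≤_ tm lm (trues≤length m))

  firstBlock : Ranking n s (suc k) → Fin (s 0)
  firstBlock (ranking l _ R B d) = toFin⁺ (ranked-ones-positive R d) (proj₁ (blockBounded-lower R (ranked-ones-positive R d) s B))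

  suc-toℕ-firstBlock : ∀ a → suc (toℕ (firstBlock a)) ≡ occurrences 1 (Ranking.entries a)
  suc-toℕ-firstBlock (ranking l _ R B d) =
    suc-toℕ-toFin⁺ (ranked-ones-positive R d) (proj₁ (blockBounded-lower R (ranked-ones-positive R d) s B))

  peel : Ranking n s (suc k) → Σ (Fin (s 0)) Peeled
  peel a@(ranking l len R B d) =
    firstBlock a ,
    mask (onesMask l) (trans (length-map (1 ≡ᵇ_) l) len) (trans (trues-onesMask l) (sym (suc-toℕ-firstBlock a))) ,
    ranking (lower (occurrences 1 l) l) (trans (length-lower l) (cong₂ _∸_ len (sym (suc-toℕ-firstBlock a))))
            (ranked-lower R (ranked-ones-positive R d)) (proj₂ (blockBounded-lower R (ranked-ones-positive R d) s B))
            (suc-injective (trans (sym (distinct-lower R (ranked-ones-positive R d))) d))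

  unpeel : Σ (Fin (s 0)) Peeled → Ranking n s (suc k)
  unpeel (i , mask m lm tm , ranking r lr R B d) = ranking (interleave m c r)
    (trans (length-interleave m c r) (trans (cong₂ _+_ tm lr) (trues+rest≡length m lm tm)))
    (ranked-interleave m r tm (s≤s z≤n) (ranked⇒positive R) R)
    (blockBounded-interleave m r tm (s≤s z≤n) (ranked⇒positive R) s (toℕ<n i) B)
    (trans (distinct-interleave m r tm (s≤s z≤n) (ranked⇒positive R)) (cong suc d))
    where
    c : ℕ
    c = suc (toℕ i)

  unpeel-peel : ∀ a → unpeel (peel a) ≡ a
  unpeel-peel a@(ranking l _ R _ _) = ranking-≡ (recompute (≡-dec _≟_ _ _)
    (trans (cong (λ c → interleave (onesMask l) c (lower (occurrences 1 l) l)) (suc-toℕ-firstBlock a))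
           (interleave-ones-lower R)))

  peel-unpeel : ∀ b → peel (unpeel b) ≡ b
  peel-unpeel b@(i , mask m lm tm , ranking r lr R _ _) = Peeled-≡ i≡ m≡ r≡
    where
    c : ℕ
    c = suc (toℕ i)
    ones≡ : occurrences 1 (interleave m c r) ≡ c
    ones≡ = recompute (_ ≟ _) (trans (occurrences-interleave-1 m r (s≤s z≤n) (ranked⇒positive R)) tm)
    i≡ : firstBlock (unpeel b) ≡ i
    i≡ = toℕ-injective (suc-injective (trans (suc-toℕ-firstBlock (unpeel b)) ones≡))
    m≡ : onesMask (interleave m c r) ≡ m
    m≡ = recompute (≡-dec Bool._≟_ _ _) (onesMask-interleave m
           (trans lm (sym (trans (cong₂ _+_ tm lr) (trues+rest≡length m lm tm))))
           (s≤s z≤n) (ranked⇒positive R))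
    r≡ : lower (occurrences 1 (interleave m c r)) (interleave m c r) ≡ r
    r≡ = recompute (≡-dec _≟_ _ _) (trans (cong (λ c′ → lower c′ (interleave m c r)) ones≡)
                                          (lower-interleave m (s≤s z≤n) (ranked⇒positive R)))

  decomposition-↔ : Ranking n s (suc k) ↔ Σ (Fin (s 0)) Peeled
  decomposition-↔ = mk↔ₛ′ peel unpeel peel-unpeel unpeel-peel

-- The multinomial sums

binomialProduct : List ℕ → ℕ
binomialProduct []       = 1
binomialProduct (c ∷ cs) = ((c + sum cs) C c) * binomialProduct cs

binomial-factorials : ∀ a b → ((a + b) C a) * (a ! * b !) ≡ (a + b) !
binomial-factorials a b = begin
  ((a + b) C a) * (a ! * b !)                ≡⟨ cong (λ d → ((a + b) C a) * (a ! * d !)) (m+n∸m≡n a b) ⟨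
  ((a + b) C a) * (a ! * (a + b ∸ a) !)      ≡⟨ cong (_* (a ! * (a + b ∸ a) !)) (nCk≡n!/k![n-k]! (m≤m+n a b)) ⟩
  ((a + b) ! / (a ! * (a + b ∸ a) !)) * (a ! * (a + b ∸ a) !) ≡⟨ m/n*n≡m (k![n∸k]!∣n! (m≤m+n a b)) ⟩
  (a + b) !                                ∎
  where
  instance
    _ : NonZero (a ! * (a + b ∸ a) !)
    _ = m*n≢0 (a !) ((a + b ∸ a) !) {{a !≢0}} {{(a + b ∸ a) !≢0}}

binomialProduct-prodFact : ∀ cs → binomialProduct cs * prodFact cs ≡ sum cs !
binomialProduct-prodFact []       = refl
binomialProduct-prodFact (c ∷ cs) = begin
  b * binomialProduct cs * (c ! * prodFact cs)   ≡⟨ regroup b (binomialProduct cs) (c !) (prodFact cs) ⟩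
  b * (c ! * (binomialProduct cs * prodFact cs)) ≡⟨ cong (λ x → b * (c ! * x)) (binomialProduct-prodFact cs) ⟩
  b * (c ! * sum cs !)                           ≡⟨ binomial-factorials c (sum cs) ⟩
  (c + sum cs) !                                 ∎
  where
  b : ℕ
  b = (c + sum cs) C c
  open +-*-Solver
  regroup : ∀ a b x y → a * b * (x * y) ≡ a * (x * (b * y))
  regroup = solve 4 (λ a b x y → a :* b :* (x :* y) := a :* (x :* (b :* y))) refl

multinomial≡binomialProduct : ∀ {N} cs → sum cs ≡ N → multinomial N cs ≡ binomialProduct cs
multinomial≡binomialProduct cs refl =
  trans (cong (λ x → (x / prodFact cs) {{prodFact≢0 cs}}) (sym (binomialProduct-prodFact cs)))
        (m*n/n≡m (binomialProduct cs) (prodFact cs) {{prodFact≢0 cs}})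

multinomial-∷ : ∀ {N c} cs → c + sum cs ≡ N → multinomial N (c ∷ cs) ≡ (N C c) * multinomial (N ∸ c) cs
multinomial-∷ {N} {c} cs c+Σ≡N = begin
  multinomial N (c ∷ cs)                 ≡⟨ multinomial≡binomialProduct (c ∷ cs) c+Σ≡N ⟩
  ((c + sum cs) C c) * binomialProduct cs  ≡⟨ cong (λ x → (x C c) * binomialProduct cs) c+Σ≡N ⟩
  (N C c) * binomialProduct cs             ≡⟨ cong ((N C c) *_) (multinomial≡binomialProduct cs Σ≡N∸c) ⟨
  (N C c) * multinomial (N ∸ c) cs         ∎
  where
  Σ≡N∸c : sum cs ≡ N ∸ c
  Σ≡N∸c = trans (sym (m+n∸m≡n c (sum cs))) (cong (_∸ c) c+Σ≡N)

weight : ℕ → List (List ℕ) → ℕ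
weight n T = sum (map (multinomial n) (filter (λ cs → sum cs ≟ n) T))

weight-accept : ∀ {n} cs T → sum cs ≡ n → weight n (cs ∷ T) ≡ multinomial n cs + weight n T
weight-accept {n} cs T Σ≡n = cong (λ T → sum (map (multinomial n) T)) (filter-accept (λ cs → sum cs ≟ n) {cs} {T} Σ≡n)

weight-reject : ∀ {n} cs T → sum cs ≢ n → weight n (cs ∷ T) ≡ weight n T
weight-reject {n} cs T Σ≢n = cong (λ T → sum (map (multinomial n) T)) (filter-reject (λ cs → sum cs ≟ n) {cs} {T} Σ≢n)

weight-concatMap : ∀ n (g : ℕ → List (List ℕ)) L → weight n (concatMap g L) ≡ sum (map (λ c → weight n (g c)) L)
weight-concatMap n g []      = refl
weight-concatMap n g (c ∷ L) = begin
  weight n (g c ++ concatMap g L)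
    ≡⟨ cong (λ T → sum (map (multinomial n) T)) (filter-++ (λ cs → sum cs ≟ n) (g c) (concatMap g L)) ⟩
  sum (map (multinomial n) (filter (λ cs → sum cs ≟ n) (g c) ++ filter (λ cs → sum cs ≟ n) (concatMap g L)))
    ≡⟨ cong sum (map-++ (multinomial n) (filter (λ cs → sum cs ≟ n) (g c)) _) ⟩
  sum (map (multinomial n) (filter (λ cs → sum cs ≟ n) (g c)) ++ map (multinomial n) (filter (λ cs → sum cs ≟ n) (concatMap g L)))
    ≡⟨ sum-++ (map (multinomial n) (filter (λ cs → sum cs ≟ n) (g c))) _ ⟩
  weight n (g c) + weight n (concatMap g L)
    ≡⟨ cong (weight n (g c) +_) (weight-concatMap n g L) ⟩
  weight n (g c) + sum (map (λ c → weight n (g c)) L) ∎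

weight-prefix-> : ∀ {n c} T → n < c → weight n (map (c ∷_) T) ≡ 0
weight-prefix-> []       n<c = refl
weight-prefix-> {n} {c} (cs ∷ T) n<c =
  trans (weight-reject (c ∷ cs) (map (c ∷_) T) too-big) (weight-prefix-> T n<c)
  where
  too-big : c + sum cs ≢ n
  too-big c+Σ≡n = <⇒≱ n<c (subst (c ≤_) c+Σ≡n (m≤m+n c (sum cs)))

weight-prefix-≤ : ∀ n c T → c ≤ n → weight n (map (c ∷_) T) ≡ (n C c) * weight (n ∸ c) T
weight-prefix-≤ n c []       c≤n = sym (*-zeroʳ (n C c))
weight-prefix-≤ n c (cs ∷ T) c≤n with sum cs ≟ n ∸ c
... | yes Σ≡n∸c = begin
  weight n (map (c ∷_) (cs ∷ T))
    ≡⟨ weight-accept (c ∷ cs) (map (c ∷_) T) c+Σ≡n ⟩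
  multinomial n (c ∷ cs) + weight n (map (c ∷_) T)
    ≡⟨ cong₂ _+_ (multinomial-∷ cs c+Σ≡n) (weight-prefix-≤ n c T c≤n) ⟩
  (n C c) * multinomial (n ∸ c) cs + (n C c) * weight (n ∸ c) T
    ≡⟨ *-distribˡ-+ (n C c) _ _ ⟨
  (n C c) * (multinomial (n ∸ c) cs + weight (n ∸ c) T)
    ≡⟨ cong ((n C c) *_) (weight-accept cs T Σ≡n∸c) ⟨
  (n C c) * weight (n ∸ c) (cs ∷ T) ∎
  where
  c+Σ≡n : c + sum cs ≡ n
  c+Σ≡n = trans (cong (c +_) Σ≡n∸c) (m+[n∸m]≡n c≤n)
... | no Σ≢n∸c = begin
  weight n (map (c ∷_) (cs ∷ T))
    ≡⟨ weight-reject (c ∷ cs) (map (c ∷_) T) c+Σ≢n ⟩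
  weight n (map (c ∷_) T)
    ≡⟨ weight-prefix-≤ n c T c≤n ⟩
  (n C c) * weight (n ∸ c) T
    ≡⟨ cong ((n C c) *_) (weight-reject cs T Σ≢n∸c) ⟨
  (n C c) * weight (n ∸ c) (cs ∷ T) ∎
  where
  c+Σ≢n : c + sum cs ≢ n
  c+Σ≢n c+Σ≡n = Σ≢n∸c (trans (sym (m+n∸m≡n c (sum cs))) (cong (_∸ c) c+Σ≡n))

weight-prefix : ∀ n c T → weight n (map (c ∷_) T) ≡ (n C c) * weight (n ∸ c) T
weight-prefix n c T with c ≤? n
... | yes c≤n = weight-prefix-≤ n c T c≤n
... | no  c≰n = trans (weight-prefix-> T (≰⇒> c≰n)) (sym (cong (_* weight (n ∸ c) T) (k>n⇒nCk≡0 (≰⇒> c≰n))))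

sum-oneTo : ∀ g m → sum (map g (oneTo m)) ≡ sum (applyUpTo (λ j → g (suc j)) m)
sum-oneTo g m = cong sum (trans (cong (map g) (map-applyUpTo (λ j → j) suc m)) (map-applyUpTo suc g m))

blockCount : ℕ → ℕ → (ℕ → ℕ) → ℕ
blockCount k n s = weight n (box s k)

blockCount-suc : ∀ k n s → blockCount (suc k) n s ≡
                 sum (applyUpTo (λ j → (n C suc j) * blockCount k (n ∸ suc j) (λ i → s (suc i))) (s 0))
blockCount-suc k n s = begin
  weight n (concatMap (λ c → map (c ∷_) (box s′ k)) (oneTo (s 0)))  ≡⟨ weight-concatMap n _ (oneTo (s 0)) ⟩
  sum (map (λ c → weight n (map (c ∷_) (box s′ k))) (oneTo (s 0)))  ≡⟨ cong sum (map-cong (λ c → weight-prefix n c (box s′ k)) (oneTo (s 0))) ⟩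
  sum (map (λ c → (n C c) * blockCount k (n ∸ c) s′) (oneTo (s 0))) ≡⟨ sum-oneTo _ (s 0) ⟩
  sum (applyUpTo (λ j → (n C suc j) * blockCount k (n ∸ suc j) s′) (s 0)) ∎
  where
  s′ : ℕ → ℕ
  s′ i = s (suc i)

rhs≡ : ∀ n s → rhs n s ≡ sum (applyUpTo (λ j → blockCount (suc j) n s) n)
rhs≡ n s = sum-oneTo (λ k → blockCount k n s) n

Ranking-↔ : ∀ k n s → Ranking n s k ↔ Fin (blockCount k n s)
Ranking-↔ zero zero s = mk↔ₛ′ (λ _ → zero) (λ _ → ranking [] refl (λ _ ()) (λ _ ()) refl) (λ { zero → refl })
  (λ { (ranking [] _ _ _ _) → refl ; (ranking (_ ∷ _) () _ _ _) })
Ranking-↔ zero (suc n) s = ¬⇒↔Fin0 λ { (ranking [] () _ _ _) ; (ranking (_ ∷ _) _ _ _ ()) }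
Ranking-↔ (suc k) n s = ↔-trans decomposition-↔ (↔-trans (Σ-Fin-↔ (s 0) _ Peeled-↔) (Fin-cong (sym (blockCount-suc k n s))))
  where
  open Decomposition n s k
  Peeled-↔ : ∀ i → Peeled i ↔ Fin ((n C suc (toℕ i)) * blockCount k (n ∸ suc (toℕ i)) (λ j → s (suc j)))
  Peeled-↔ i = ↔-trans (Mask-↔ n (suc (toℕ i)) ×-↔ Ranking-↔ k (n ∸ suc (toℕ i)) _) (↔-sym *↔×)

occ≡occurrences : ∀ {n} x (α : Vec ℕ n) → occ x α ≡ occurrences x (toList α)
occ≡occurrences x []      = refl
occ≡occurrences x (y ∷ α) with x ≡ᵇ y
... | true  = cong suc (occ≡occurrences x α)
... | false = occ≡occurrences x α

partialC≡blockOffset : ∀ {n} (α : Vec ℕ n) i → partialC α i ≡ blockOffset (toList α) i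
posC≡blockSize       : ∀ {n} (α : Vec ℕ n) i → posC α i ≡ blockSize (toList α) i
partialC≡blockOffset α zero    = refl
partialC≡blockOffset α (suc i) = cong₂ _+_ (partialC≡blockOffset α i) (posC≡blockSize α i)
posC≡blockSize α i = trans (occ≡occurrences (suc (partialC α i)) α)
                           (cong (λ o → occurrences (suc o) (toList α)) (partialC≡blockOffset α i))

blockSequence⇔blockBounded : ∀ {n} s (α : Vec ℕ n) → IsBlockSequence s α ⇔ BlockBounded s (toList α)
blockSequence⇔blockBounded s α = mk⇔ (λ B i i<d → subst (_≤ s i) (posC≡blockSize α i) (B i i<d))
                                     (λ B i i<d → subst (_≤ s i) (sym (posC≡blockSize α i)) (B i i<d))

fubini⇒ranked : ∀ {n} (α : Vec ℕ n) → IsFubiniRanking n α → Ranked (toList α)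
fubini⇒ranked α F = next⇒ranked
  (λ x x∈ → proj₁ (ListAll.lookup (VecAll.toList⁺ inRange) x∈))
  (ListAny.map sym (VecAny.toList⁺ hasOne))
  (NextValue-cong (λ x → occ≡occurrences x α) next)
  where open IsFubiniRanking F

ranked⇒fubini : ∀ {n} (α : Vec ℕ n) → 1 ≤ n → Ranked (toList α) → IsFubiniRanking n α
ranked⇒fubini α@(_ ∷ _) _ R = record
  { inRange = VecAll.toList⁻ (ListAll.tabulate λ {x} x∈ →
                ranked-positive R x∈ , subst (x ≤_) (length-toList α) (ranked⇒≤length R x∈))
  ; hasOne  = VecAny.toList⁻ (ListAny.map sym (ranked⇒1∈ R))
  ; next    = NextValue-cong (λ x → sym (occ≡occurrences x α)) (ranked⇒next R)
  }

toVec : ∀ (l : List ℕ) {n} → .(length l ≡ n) → Vec ℕ n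
toVec []      {zero}  _ = []
toVec (x ∷ l) {suc n} e = x ∷ toVec l (suc-injective e)

toList-toVec : ∀ l {n} .(e : length l ≡ n) → toList (toVec l e) ≡ l
toList-toVec []      {zero}  _ = refl
toList-toVec (x ∷ l) {suc n} e = cong (x ∷_) (toList-toVec l (suc-injective e))

toVec-toList : ∀ {n} (α : Vec ℕ n) .(e : length (toList α) ≡ n) → toVec (toList α) e ≡ α
toVec-toList []      _ = refl
toVec-toList (x ∷ α) e = cong (x ∷_) (toVec-toList α (suc-injective e))

distinct-toList-bounds : ∀ {n} (α : Vec ℕ n) → 1 ≤ n → 1 ≤ distinct (toList α) × distinct (toList α) ≤ n
distinct-toList-bounds α@(_ ∷ _) _ =
  s≤s z≤n , subst (distinct (toList α) ≤_) (length-toList α) (length-deduplicate _≟_ (toList α))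

module _ {n : ℕ} (n≥1 : 1 ≤ n) (s : ℕ → ℕ) where

  ByDistinct : Fin n → Set
  ByDistinct i = Ranking n s (suc (toℕ i))

  toRanking : FR-T3 n s → Σ (Fin n) ByDistinct
  toRanking (fr α F B) = toFin⁺ (proj₁ bounds) (proj₂ bounds) ,
    ranking (toList α) (length-toList α) (fubini⇒ranked α F) (Equivalence.to (blockSequence⇔blockBounded s α) B)
            (sym (suc-toℕ-toFin⁺ (proj₁ bounds) (proj₂ bounds)))
    where
    bounds : 1 ≤ distinct (toList α) × distinct (toList α) ≤ n
    bounds = distinct-toList-bounds α n≥1

  fromRanking : Σ (Fin n) ByDistinct → FR-T3 n s
  fromRanking (i , ranking l len R B d) = fr (toVec l len)
    (ranked⇒fubini (toVec l len) n≥1 (subst Ranked (sym (toList-toVec l len)) R))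
    (Equivalence.from (blockSequence⇔blockBounded s (toVec l len)) (subst (BlockBounded s) (sym (toList-toVec l len)) B))

  toRanking-fromRanking : ∀ b → toRanking (fromRanking b) ≡ b
  toRanking-fromRanking (i , ranking l len _ _ d) = ByDistinct-≡ i≡ (toList-toVec l len)
    where
    bounds : 1 ≤ distinct (toList (toVec l len)) × distinct (toList (toVec l len)) ≤ n
    bounds = distinct-toList-bounds (toVec l len) n≥1
    i≡ : toFin⁺ (proj₁ bounds) (proj₂ bounds) ≡ i
    i≡ = toℕ-injective (suc-injective (trans (suc-toℕ-toFin⁺ (proj₁ bounds) (proj₂ bounds))
           (trans (cong distinct (toList-toVec l len)) (recompute (_ ≟ _) d))))
    ByDistinct-≡ : ∀ {i i′ l l′} .{a b c d a′ b′ c′ d′} → i ≡ i′ → l ≡ l′ →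
                   _≡_ {A = Σ (Fin n) ByDistinct} (i , ranking l a b c d) (i′ , ranking l′ a′ b′ c′ d′)
    ByDistinct-≡ refl refl = refl

  fromRanking-toRanking : ∀ a → fromRanking (toRanking a) ≡ a
  fromRanking-toRanking (fr α _ _) = fr-≡ (toVec-toList α _)
    where
    fr-≡ : ∀ {α α′ : Vec ℕ n} .{a b a′ b′} → α ≡ α′ → fr {n} {s} α a b ≡ fr α′ a′ b′
    fr-≡ refl = refl

  FR-T3-↔ : FR-T3 n s ↔ Σ (Fin n) ByDistinct
  FR-T3-↔ = mk↔ₛ′ toRanking fromRanking toRanking-fromRanking fromRanking-toRanking

theorem5p5 : (n : ℕ) → 1 ≤ n → (s : ℕ → ℕ) → (∀ i → 0 < s i) →
    FR-T3 n s ↔ Fin (rhs n s)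
theorem5p5 n n≥1 s _ = ↔-trans (FR-T3-↔ n≥1 s)
  (↔-trans (Σ-Fin-↔ n _ (λ i → Ranking-↔ (suc (toℕ i)) n s)) (Fin-cong (sym (rhs≡ n s))))
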